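{- Let $G$ be a connected signed graph with $n$ vertices and $m$ edges, let $k$ be an integer, and let $v$ be a vertex of degree $1$ in $G$. Let $G'=G-v$ (with $n-1$ vertices and $m-1$ edges) and $k'=k-1$. Then $G$ has a balanced subgraph with at least $\frac{m}{2}+\frac{n-1}{4}+\frac{k}{4}$ edges if and only if $G'$ has a balanced subgraph with at least $\frac{m-1}{2}+\frac{n-2}{4}+\frac{k'}{4}$ edges.
   Context: A signed graph is a simple undirected graph in which each edge is labelled positive or negative. A signed graph is balanced if there is a partition $(V_1,V_2)$ of its vertex set such that every edge with both endpoints in the same part is positive and every edge with endpoints in different parts is negative. A balanced subgraph of $G$ means a subgraph of $G$ that is balanced. -}

module Defs where

open import Data.Bool using (Bool; true; false; _∧_)
open import Data.Nat using (ℕ; zero; suc; _<ᵇ_)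
open import Data.Fin using (Fin; toℕ; punchIn)
open import Data.List using (List; length; filterᵇ; map; concatMap; allFin)
open import Data.Product using (_×_; _,_; Σ; ∃)
open import Data.Integer using (ℤ; _≤_)
open import Relation.Binary.PropositionalEquality using (_≡_)
open import Function.Bundles using (_⇔_)

data Sign : Set where
  pos neg : Sign

-- A simple undirected signed graph on vertex set Fin n.
-- adj i j = true  iff  {i,j} is an edge; sign i j is its label
-- (the value of sign on non-edges is irrelevant).
record SignedGraph (n : ℕ) : Set where
  field
    adj        : Fin n → Fin n → Bool
    sign       : Fin n → Fin n → Sign
    adj-sym    : ∀ i j → adj i j ≡ adj j i
    adj-irrefl : ∀ i → adj i i ≡ false
    sign-sym   : ∀ i j → sign i j ≡ sign j i
open SignedGraph public

allPairs : (n : ℕ) → List (Fin n × Fin n)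
allPairs n = concatMap (λ i → map (λ j → (i , j)) (allFin n)) (allFin n)

countPairs : (n : ℕ) → (Fin n → Fin n → Bool) → ℕ
countPairs n e = length (filterᵇ (λ { (i , j) → (toℕ i <ᵇ toℕ j) ∧ e i j }) (allPairs n))

edgeCount : ∀ {n} → SignedGraph n → ℕ
edgeCount {n} G = countPairs n (adj G)

degree : ∀ {n} → SignedGraph n → Fin n → ℕ
degree {n} G v = length (filterᵇ (adj G v) (allFin n))

data Walk {n : ℕ} (G : SignedGraph n) : Fin n → Fin n → Set where
  here : ∀ {i} → Walk G i i
  step : ∀ {i j k} → adj G i j ≡ true → Walk G j k → Walk G i k

Connected : ∀ {n} → SignedGraph n → Set
Connected {n} G = ∀ (i j : Fin n) → Walk G i j

record Subgraph {n : ℕ} (G : SignedGraph n) : Set where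
  field
    vsub     : Fin n → Bool
    esub     : Fin n → Fin n → Bool
    esub-sym : ∀ i j → esub i j ≡ esub j i
    esub-adj : ∀ i j → esub i j ≡ true → adj G i j ≡ true
    esub-end : ∀ i j → esub i j ≡ true → (vsub i ≡ true × vsub j ≡ true)
open Subgraph public

subEdgeCount : ∀ {n} {G : SignedGraph n} → Subgraph G → ℕ
subEdgeCount {n} H = countPairs n (esub H)

-- H is balanced: there is a partition (V₁,V₂) of its vertex set (given by
-- part : Fin n → Bool, restricted to the vertices of H) such that an edge
-- of H is positive iff its endpoints lie in the same part.
Balanced : ∀ {n} {G : SignedGraph n} → Subgraph G → Set
Balanced {n} {G} H =
  Σ (Fin n → Bool) λ part →
    ∀ i j → esub H i j ≡ true → ((sign G i j ≡ pos) ⇔ (part i ≡ part j))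

HasBalancedAtLeast4 : ∀ {n} → SignedGraph n → ℤ → Set
HasBalancedAtLeast4 G t =
  Σ (Subgraph G) λ H → Balanced H × (t ≤ Data.Integer.+ (4 Data.Nat.* subEdgeCount H))

deleteVertex : ∀ {n} → SignedGraph (suc n) → Fin (suc n) → SignedGraph n
deleteVertex G v = record
  { adj        = λ i j → adj G (punchIn v i) (punchIn v j)
  ; sign       = λ i j → sign G (punchIn v i) (punchIn v j)
  ; adj-sym    = λ i j → adj-sym G (punchIn v i) (punchIn v j)
  ; adj-irrefl = λ i → adj-irrefl G (punchIn v i)
  ; sign-sym   = λ i j → sign-sym G (punchIn v i) (punchIn v j)
  }

-- A balanced subgraph of G loses at most one edge when restricted to G - v,
-- since v has only one edge vu.  Conversely a balanced subgraph of G - v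
-- extends to G by adding vu, with v placed on u's side or on the opposite
-- side according to the sign of vu; this gains exactly one edge.  The two
-- thresholds differ by exactly one edge, so the conditions are equivalent.
module Submission where

open import Defs
open import Data.Empty using (⊥-elim)
open import Data.Bool using (Bool; true; false; not; _∧_; T?)
open import Data.Bool.Properties using (∧-conicalˡ; ∧-conicalʳ; ∧-identityʳ; ∧-zeroʳ; T-≡)
open import Data.Fin using (Fin; zero; suc; toℕ; punchIn; punchOut; _≟_)
open import Data.Fin.Properties using (punchIn-punchOut; punchIn-injective; toℕ-injective)
open import Data.List using (List; []; _∷_; length; filterᵇ; allFin)
open import Data.List.Membership.Propositional using (_∈_)
open import Data.List.Membership.Propositional.Properties using (∈-allFin; ∈-filter⁺; ∈-filter⁻)
open import Data.List.Relation.Unary.Any using (here)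
open import Data.Nat using (ℕ; zero; suc)
open import Data.Product using (Σ; _×_; _,_; proj₂)
open import Data.Vec.Functional using (insertAt)
open import Data.Vec.Functional.Properties using (insertAt-lookup; insertAt-punchIn)
open import Function using (_∘_)
open import Function.Bundles using (_⇔_; mk⇔; Equivalence)
open import Relation.Nullary using (yes; no)
open import Relation.Binary.PropositionalEquality
  using (_≡_; _≢_; refl; sym; trans; cong; cong₂; subst; module ≡-Reasoning)

data PunchInView {n} (v : Fin (suc n)) : Fin (suc n) → Set where
  pivot   : PunchInView v v
  punched : ∀ i → PunchInView v (punchIn v i)

punchInView : ∀ {n} (v x : Fin (suc n)) → PunchInView v x
punchInView v x with v ≟ x
... | yes refl = pivot
... | no v≢x   = subst (PunchInView v) (punchIn-punchOut v≢x) (punched (punchOut v≢x))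

∧-redundantˡ : ∀ {a b} → (b ≡ true → a ≡ true) → a ∧ b ≡ b
∧-redundantˡ {a} {false} _ = ∧-zeroʳ a
∧-redundantˡ {b = true} b⇒a = trans (∧-identityʳ _) (b⇒a refl)

-- across s b: the side of one end of an s-edge whose other end lies on side b
across : Sign → Bool → Bool
across pos b = b
across neg b = not b

pos⇔across-≡ : ∀ s b → (s ≡ pos) ⇔ (across s b ≡ b)
pos⇔across-≡ pos b     = mk⇔ (λ _ → refl) (λ _ → refl)
pos⇔across-≡ neg true  = mk⇔ (λ ()) (λ ())
pos⇔across-≡ neg false = mk⇔ (λ ()) (λ ())

esub-irrefl : ∀ {n} {G : SignedGraph n} (H : Subgraph G) i → esub H i i ≡ false
esub-irrefl {G = G} H i with esub H i i in e
... | false = refl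
... | true with () ← trans (sym (esub-adj H i i e)) (adj-irrefl G i)

restrict : ∀ {n} {G : SignedGraph (suc n)} (v : Fin (suc n)) → Subgraph G → Subgraph (deleteVertex G v)
restrict v H = record
  { vsub     = vsub H ∘ punchIn v
  ; esub     = λ i j → esub H (punchIn v i) (punchIn v j)
  ; esub-sym = λ i j → esub-sym H (punchIn v i) (punchIn v j)
  ; esub-adj = λ i j → esub-adj H (punchIn v i) (punchIn v j)
  ; esub-end = λ i j → esub-end H (punchIn v i) (punchIn v j)
  }

restrict-balanced : ∀ {n} {G : SignedGraph (suc n)} (v : Fin (suc n)) (H : Subgraph G) →
                    Balanced H → Balanced (restrict v H)
restrict-balanced v H (part , bal) = part ∘ punchIn v , λ i j → bal (punchIn v i) (punchIn v j)

-- R read through punchIn v, and true on every pair involving v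
withPivot : ∀ {n} → Fin (suc n) → (Fin n → Fin n → Bool) → Fin (suc n) → Fin (suc n) → Bool
withPivot v R = insertAt (λ i → insertAt (R i) v true) v (λ _ → true)

module _ {n} (v : Fin (suc n)) (R : Fin n → Fin n → Bool) where

  withPivot-pivotˡ : ∀ y → withPivot v R v y ≡ true
  withPivot-pivotˡ y = cong (λ row → row y) (insertAt-lookup (λ i → insertAt (R i) v true) v (λ _ → true))

  withPivot-punchIn : ∀ i y → withPivot v R (punchIn v i) y ≡ insertAt (R i) v true y
  withPivot-punchIn i y = cong (λ row → row y) (insertAt-punchIn (λ i → insertAt (R i) v true) v (λ _ → true) i)

  withPivot-pivotʳ : ∀ i → withPivot v R (punchIn v i) v ≡ true
  withPivot-pivotʳ i = trans (withPivot-punchIn i v) (insertAt-lookup (R i) v true)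

  withPivot-punchIn² : ∀ i j → withPivot v R (punchIn v i) (punchIn v j) ≡ R i j
  withPivot-punchIn² i j = trans (withPivot-punchIn i (punchIn v j)) (insertAt-punchIn (R i) v true j)

  withPivot-sym : (∀ i j → R i j ≡ R j i) → ∀ x y → withPivot v R x y ≡ withPivot v R y x
  withPivot-sym R-sym x y with punchInView v x | punchInView v y
  ... | pivot     | pivot     = refl
  ... | pivot     | punched j = trans (withPivot-pivotˡ _) (sym (withPivot-pivotʳ j))
  ... | punched i | pivot     = trans (withPivot-pivotʳ i) (sym (withPivot-pivotˡ _))
  ... | punched i | punched j =
    trans (withPivot-punchIn² i j) (trans (R-sym i j) (sym (withPivot-punchIn² j i)))

extend : ∀ {n} (G : SignedGraph (suc n)) (v : Fin (suc n)) → Subgraph (deleteVertex G v) → Subgraph G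
extend G v H′ = record
  { vsub     = λ _ → true
  ; esub     = λ x y → adj G x y ∧ withPivot v (esub H′) x y
  ; esub-sym = λ x y → cong₂ _∧_ (adj-sym G x y) (withPivot-sym v (esub H′) (esub-sym H′) x y)
  ; esub-adj = λ x y → ∧-conicalˡ _ _
  ; esub-end = λ _ _ _ → refl , refl
  }

extend-balanced : ∀ {n} (G : SignedGraph (suc n)) (v : Fin (suc n)) (H′ : Subgraph (deleteVertex G v))
                  (u : Fin n) → (∀ y → adj G v y ≡ true → y ≡ punchIn v u) →
                  Balanced H′ → Balanced (extend G v H′)
extend-balanced G v H′ u sole (part′ , bal′) = part , bal
  where
  s : Sign
  s = sign G v (punchIn v u)

  part : Fin _ → Bool
  part = insertAt part′ v (across s (part′ u))

  part-punchIn : ∀ i → part (punchIn v i) ≡ part′ i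
  part-punchIn i = insertAt-punchIn part′ v (across s (part′ u)) i

  v-side : (s ≡ pos) ⇔ (part v ≡ part (punchIn v u))
  v-side rewrite insertAt-lookup part′ v (across s (part′ u)) | part-punchIn u = pos⇔across-≡ s (part′ u)

  v-edge : ∀ j → adj G v (punchIn v j) ≡ true → (sign G v (punchIn v j) ≡ pos) ⇔ (part v ≡ part (punchIn v j))
  v-edge j e with punchIn-injective v j u (sole _ e)
  ... | refl = v-side

  bal : ∀ x y → esub (extend G v H′) x y ≡ true → (sign G x y ≡ pos) ⇔ (part x ≡ part y)
  bal x y e with punchInView v x | punchInView v y
  ... | pivot     | pivot with () ← trans (sym (∧-conicalˡ _ _ e)) (adj-irrefl G v)
  ... | pivot     | punched j = v-edge j (∧-conicalˡ _ _ e)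
  ... | punched i | pivot rewrite sign-sym G (punchIn v i) v =
    mk⇔ (sym ∘ Equivalence.to flipped) (Equivalence.from flipped ∘ sym)
    where
    flipped : (sign G v (punchIn v i) ≡ pos) ⇔ (part v ≡ part (punchIn v i))
    flipped = v-edge i (trans (adj-sym G v (punchIn v i)) (∧-conicalˡ _ _ e))
  ... | punched i | punched j rewrite part-punchIn i | part-punchIn j =
    bal′ i j (trans (sym (withPivot-punchIn² v (esub H′) i j)) (∧-conicalʳ _ _ e))

length≡1⇒singleton : ∀ {A : Set} {xs : List A} → length xs ≡ 1 → Σ A λ x → xs ≡ x ∷ []
length≡1⇒singleton {xs = x ∷ []} refl = x , refl

uniqueNeighbour : ∀ {n} (G : SignedGraph n) v → degree G v ≡ 1 →
                  Σ (Fin n) λ w → adj G v w ≡ true × (∀ y → adj G v y ≡ true → y ≡ w)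
uniqueNeighbour G v deg with length≡1⇒singleton deg
... | w , nbrs≡[w] = w , adj-vw , only-w
  where
  adj-vw : adj G v w ≡ true
  adj-vw = Equivalence.to T-≡ (proj₂ (∈-filter⁻ (T? ∘ adj G v) {xs = allFin _} (subst (w ∈_) (sym nbrs≡[w]) (here refl))))

  only-w : ∀ y → adj G v y ≡ true → y ≡ w
  only-w y e with subst (y ∈_) nbrs≡[w] (∈-filter⁺ (T? ∘ adj G v) (∈-allFin y) (Equivalence.from T-≡ e))
  ... | here y≡w = y≡w

soleNeighbour : ∀ {n} (G : SignedGraph (suc n)) v → degree G v ≡ 1 →
                Σ (Fin n) λ u → ∀ y → adj G v y ≡ true → y ≡ punchIn v u
soleNeighbour G v deg with uniqueNeighbour G v deg
... | w , adj-vw , only-w with punchInView v w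
...   | pivot with () ← trans (sym adj-vw) (adj-irrefl G v)
...   | punched u = u , only-w

module EdgeCounting where

  open import Data.Nat using (_+_; _≤_; _<ᵇ_; z≤n)
  open import Data.Nat.Properties using (+-0-commutativeMonoid; +-assoc; +-identityʳ; +-mono-≤; +-monoˡ-≤; ≤-refl; module ≤-Reasoning)
  open import Data.List using (tabulate; map; concatMap; _++_)
  open import Data.List.Properties using (filter-++; length-++; map-tabulate)
  open import Algebra.Properties.CommutativeMonoid.Sum +-0-commutativeMonoid
    using (sum; sum-syntax; sum-remove; ∑-distrib-+; sum-cong-≗)

  [_] : Bool → ℕ
  [ true ]  = 1
  [ false ] = 0

  [_]-mono : ∀ {a b} → (a ≡ true → b ≡ true) → [ a ] ≤ [ b ]
  [_]-mono {false}         _   = z≤n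
  [_]-mono {true} {true}   _   = ≤-refl
  [_]-mono {true} {false} a⇒b with () ← a⇒b refl

  ∑-mono-≤ : ∀ {n} {f g : Fin n → ℕ} → (∀ i → f i ≤ g i) → sum f ≤ sum g
  ∑-mono-≤ {zero}  f≤g = z≤n
  ∑-mono-≤ {suc n} f≤g = +-mono-≤ (f≤g zero) (∑-mono-≤ (f≤g ∘ suc))

  length-filterᵇ-tabulate : ∀ {A : Set} {n} (p : A → Bool) (f : Fin n → A) →
                            length (filterᵇ p (tabulate f)) ≡ ∑[ i < n ] [ p (f i) ]
  length-filterᵇ-tabulate {n = zero}  p f = refl
  length-filterᵇ-tabulate {n = suc n} p f with p (f zero)
  ... | true  = cong suc (length-filterᵇ-tabulate p (f ∘ suc))
  ... | false = length-filterᵇ-tabulate p (f ∘ suc)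

  length-filterᵇ-concatMap-tabulate :
    ∀ {A B : Set} {n} (p : B → Bool) (g : A → List B) (f : Fin n → A) →
    length (filterᵇ p (concatMap g (tabulate f))) ≡ ∑[ i < n ] length (filterᵇ p (g (f i)))
  length-filterᵇ-concatMap-tabulate {n = zero}  p g f = refl
  length-filterᵇ-concatMap-tabulate {n = suc n} p g f = begin
    length (filterᵇ p (g (f zero) ++ concatMap g (tabulate (f ∘ suc))))
      ≡⟨ cong length (filter-++ (T? ∘ p) (g (f zero)) _) ⟩
    length (filterᵇ p (g (f zero)) ++ filterᵇ p (concatMap g (tabulate (f ∘ suc))))
      ≡⟨ length-++ (filterᵇ p (g (f zero))) ⟩
    length (filterᵇ p (g (f zero))) + length (filterᵇ p (concatMap g (tabulate (f ∘ suc))))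
      ≡⟨ cong (length (filterᵇ p (g (f zero))) +_) (length-filterᵇ-concatMap-tabulate p g (f ∘ suc)) ⟩
    ∑[ i < suc n ] length (filterᵇ p (g (f i)))
      ∎
    where open ≡-Reasoning

  degree≡∑ : ∀ {n} (G : SignedGraph n) v → degree G v ≡ ∑[ j < n ] [ adj G v j ]
  degree≡∑ G v = length-filterᵇ-tabulate (adj G v) (λ j → j)

  ascending : ∀ {n} → (Fin n → Fin n → Bool) → Fin n → Fin n → ℕ
  ascending e i j = [ (toℕ i <ᵇ toℕ j) ∧ e i j ]

  length-filterᵇ-allPairs : ∀ n (p : Fin n × Fin n → Bool) →
                            length (filterᵇ p (allPairs n)) ≡ ∑[ i < n ] ∑[ j < n ] [ p (i , j) ]
  length-filterᵇ-allPairs n p = trans (length-filterᵇ-concatMap-tabulate p (λ i → map (i ,_) (allFin n)) (λ i → i))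
    (sum-cong-≗ λ i → trans (cong (length ∘ filterᵇ p) (map-tabulate (λ j → j) (i ,_)))
                            (length-filterᵇ-tabulate p (i ,_)))

  countPairs≡∑∑ : ∀ n (e : Fin n → Fin n → Bool) →
                  countPairs n e ≡ ∑[ i < n ] ∑[ j < n ] ascending e i j
  countPairs≡∑∑ n e = length-filterᵇ-allPairs n _

  <ᵇ-irrefl : ∀ m → (m <ᵇ m) ≡ false
  <ᵇ-irrefl zero    = refl
  <ᵇ-irrefl (suc m) = <ᵇ-irrefl m

  toℕ-punchIn-<ᵇ : ∀ {n} (v : Fin (suc n)) i j →
                   (toℕ (punchIn v i) <ᵇ toℕ (punchIn v j)) ≡ (toℕ i <ᵇ toℕ j)
  toℕ-punchIn-<ᵇ zero    i       j       = refl
  toℕ-punchIn-<ᵇ (suc v) zero    zero    = refl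
  toℕ-punchIn-<ᵇ (suc v) zero    (suc j) = refl
  toℕ-punchIn-<ᵇ (suc v) (suc i) zero    = refl
  toℕ-punchIn-<ᵇ (suc v) (suc i) (suc j) = toℕ-punchIn-<ᵇ v i j

  <ᵇ-∧-flip : ∀ a b c → a ≢ b → [ (a <ᵇ b) ∧ c ] + [ (b <ᵇ a) ∧ c ] ≡ [ c ]
  <ᵇ-∧-flip zero    zero    c a≢b = ⊥-elim (a≢b refl)
  <ᵇ-∧-flip zero    (suc b) c _   = +-identityʳ [ c ]
  <ᵇ-∧-flip (suc a) zero    c _   = refl
  <ᵇ-∧-flip (suc a) (suc b) c a≢b = <ᵇ-∧-flip a b c (a≢b ∘ cong suc)

  ascending-diagonal : ∀ {n} (e : Fin n → Fin n → Bool) i → ascending e i i ≡ 0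
  ascending-diagonal e i = cong (λ b → [ b ∧ e i i ]) (<ᵇ-irrefl (toℕ i))

  ascending-+-flip : ∀ {n} (e : Fin n → Fin n → Bool) → (∀ i j → e i j ≡ e j i) → (∀ i → e i i ≡ false) →
                     ∀ i j → ascending e i j + ascending e j i ≡ [ e i j ]
  ascending-+-flip e e-sym e-irrefl i j with i ≟ j
  ... | yes refl = trans (cong₂ _+_ (ascending-diagonal e i) (ascending-diagonal e i))
                         (cong [_] (sym (e-irrefl i)))
  ... | no i≢j rewrite e-sym j i = <ᵇ-∧-flip (toℕ i) (toℕ j) (e i j) (i≢j ∘ toℕ-injective)

  countPairs-cong : ∀ n {e e′ : Fin n → Fin n → Bool} → (∀ i j → e i j ≡ e′ i j) → countPairs n e ≡ countPairs n e′
  countPairs-cong n {e} {e′} e≗e′ = begin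
    countPairs n e                             ≡⟨ countPairs≡∑∑ n e ⟩
    ∑[ i < n ] ∑[ j < n ] ascending e i j      ≡⟨ sum-cong-≗ (λ i → sum-cong-≗ λ j → cong (λ b → [ _ ∧ b ]) (e≗e′ i j)) ⟩
    ∑[ i < n ] ∑[ j < n ] ascending e′ i j     ≡⟨ countPairs≡∑∑ n e′ ⟨
    countPairs n e′                            ∎
    where open ≡-Reasoning

  countPairs-punchIn : ∀ {n} (e : Fin (suc n) → Fin (suc n) → Bool) →
                       (∀ i j → e i j ≡ e j i) → (∀ i → e i i ≡ false) → ∀ v →
                       countPairs (suc n) e ≡ ∑[ j < suc n ] [ e v j ] + countPairs n (λ i j → e (punchIn v i) (punchIn v j))
  countPairs-punchIn {n} e e-sym e-irrefl v = begin
    countPairs (suc n) e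
      ≡⟨ countPairs≡∑∑ (suc n) e ⟩
    ∑[ i < suc n ] ∑[ j < suc n ] a i j
      ≡⟨ sum-remove {i = v} row ⟩
    row v + ∑[ i < n ] row (punchIn v i)
      ≡⟨ cong (row v +_) (sum-cong-≗ λ i → sum-remove {i = v} (a (punchIn v i))) ⟩
    row v + ∑[ i < n ] (a (punchIn v i) v + rest i)
      ≡⟨ cong (row v +_) (∑-distrib-+ (λ i → a (punchIn v i) v) rest) ⟩
    row v + (∑[ i < n ] a (punchIn v i) v + ∑[ i < n ] rest i)
      ≡⟨ +-assoc (row v) _ _ ⟨
    row v + ∑[ i < n ] a (punchIn v i) v + ∑[ i < n ] rest i
      ≡⟨ cong (λ c → row v + c + ∑[ i < n ] rest i) column ⟩
    row v + ∑[ i < suc n ] a i v + ∑[ i < n ] rest i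
      ≡⟨ cong (_+ ∑[ i < n ] rest i) (∑-distrib-+ (a v) (λ i → a i v)) ⟨
    ∑[ j < suc n ] (a v j + a j v) + ∑[ i < n ] rest i
      ≡⟨ cong₂ _+_ (sum-cong-≗ (ascending-+-flip e e-sym e-irrefl v)) inner ⟩
    ∑[ j < suc n ] [ e v j ] + countPairs n e′
      ∎
    where
    open ≡-Reasoning
    a : Fin (suc n) → Fin (suc n) → ℕ
    a = ascending e
    row : Fin (suc n) → ℕ
    row i = ∑[ j < suc n ] a i j
    e′ : Fin n → Fin n → Bool
    e′ i j = e (punchIn v i) (punchIn v j)
    rest : Fin n → ℕ
    rest i = ∑[ j < n ] a (punchIn v i) (punchIn v j)
    column : ∑[ i < n ] a (punchIn v i) v ≡ ∑[ i < suc n ] a i v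
    column = sym (trans (sum-remove {i = v} (λ i → a i v))
                       (cong (_+ ∑[ i < n ] a (punchIn v i) v) (ascending-diagonal e v)))
    inner : ∑[ i < n ] rest i ≡ countPairs n e′
    inner = trans (sum-cong-≗ λ i → sum-cong-≗ λ j → cong (λ b → [ b ∧ e′ i j ]) (toℕ-punchIn-<ᵇ v i j))
                  (sym (countPairs≡∑∑ n e′))

  subEdgeCount-restrict : ∀ {n} {G : SignedGraph (suc n)} v (H : Subgraph G) →
                          subEdgeCount H ≤ degree G v + subEdgeCount (restrict v H)
  subEdgeCount-restrict {n} {G} v H = begin
    subEdgeCount H
      ≡⟨ countPairs-punchIn (esub H) (esub-sym H) (esub-irrefl H) v ⟩
    ∑[ j < suc n ] [ esub H v j ] + subEdgeCount (restrict v H)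
      ≤⟨ +-monoˡ-≤ _ (∑-mono-≤ λ j → [_]-mono (esub-adj H v j)) ⟩
    ∑[ j < suc n ] [ adj G v j ] + subEdgeCount (restrict v H)
      ≡⟨ cong (_+ subEdgeCount (restrict v H)) (degree≡∑ G v) ⟨
    degree G v + subEdgeCount (restrict v H)
      ∎
    where open ≤-Reasoning

  subEdgeCount-extend : ∀ {n} (G : SignedGraph (suc n)) v (H′ : Subgraph (deleteVertex G v)) →
                        subEdgeCount (extend G v H′) ≡ degree G v + subEdgeCount H′
  subEdgeCount-extend {n} G v H′ = begin
    subEdgeCount H
      ≡⟨ countPairs-punchIn (esub H) (esub-sym H) (esub-irrefl H) v ⟩
    ∑[ j < suc n ] [ esub H v j ] + countPairs n (λ i j → esub H (punchIn v i) (punchIn v j))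
      ≡⟨ cong₂ _+_ (sum-cong-≗ λ j → cong [_] (v-row j)) (countPairs-cong n old-edges) ⟩
    ∑[ j < suc n ] [ adj G v j ] + subEdgeCount H′
      ≡⟨ cong (_+ subEdgeCount H′) (degree≡∑ G v) ⟨
    degree G v + subEdgeCount H′
      ∎
    where
    open ≡-Reasoning
    H : Subgraph G
    H = extend G v H′
    v-row : ∀ j → esub H v j ≡ adj G v j
    v-row j = trans (cong (adj G v j ∧_) (withPivot-pivotˡ v (esub H′) j)) (∧-identityʳ _)
    old-edges : ∀ i j → esub H (punchIn v i) (punchIn v j) ≡ esub H′ i j
    old-edges i j = trans (cong (_ ∧_) (withPivot-punchIn² v (esub H′) i j)) (∧-redundantˡ (esub-adj H′ i j))

open EdgeCounting using (subEdgeCount-restrict; subEdgeCount-extend)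

open import Data.Integer using (ℤ; +_; _+_; _-_; _*_; -_; _≤_; +≤+)
open import Data.Integer.Properties using (≤-trans; +-monoˡ-≤; pos-+)
open import Data.Integer.Tactic.RingSolver using (solve-∀)
import Data.Nat as ℕ
import Data.Nat.Properties as ℕ

threshold-shift : ∀ (m N k : ℤ) → + 2 * (m - + 1) + (N - + 2) + (k - + 1) ≡ (+ 2 * m + (N - + 1) + k) - + 4
threshold-shift = solve-∀

pos-4*suc : ∀ h → + (4 ℕ.* suc h) ≡ + (4 ℕ.* h) + + 4
pos-4*suc h = trans (cong +_ (trans (ℕ.*-suc 4 h) (ℕ.+-comm 4 (4 ℕ.* h)))) (pos-+ (4 ℕ.* h) 4)

≤-4*suc⇔ : ∀ (t : ℤ) h → t ≤ + (4 ℕ.* suc h) ⇔ t - + 4 ≤ + (4 ℕ.* h)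
≤-4*suc⇔ t h rewrite pos-4*suc h =
  mk⇔ (λ t≤s+4 → subst (t - + 4 ≤_) (cancel (+ (4 ℕ.* h))) (+-monoˡ-≤ (- + 4) t≤s+4))
      (λ t-4≤s → subst (_≤ + (4 ℕ.* h) + + 4) (cancel′ t) (+-monoˡ-≤ (+ 4) t-4≤s))
  where
  cancel : ∀ s → s + + 4 - + 4 ≡ s
  cancel = solve-∀
  cancel′ : ∀ t → t - + 4 + + 4 ≡ t
  cancel′ = solve-∀

lemma4p6 : ∀ {n : ℕ} (G : SignedGraph (suc n)) (k : ℤ) (v : Fin (suc n))
    → Connected G → degree G v ≡ 1
    → HasBalancedAtLeast4 G (+ 2 * + edgeCount G + (+ suc n - + 1) + k)
      ⇔ HasBalancedAtLeast4 (deleteVertex G v) (+ 2 * (+ edgeCount G - + 1) + (+ suc n - + 2) + (k - + 1))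
lemma4p6 {n} G k v _ deg = mk⇔ shrink grow
  where
  T T′ : ℤ
  T  = + 2 * + edgeCount G + (+ suc n - + 1) + k
  T′ = + 2 * (+ edgeCount G - + 1) + (+ suc n - + 2) + (k - + 1)

  T′≡T-4 : T′ ≡ T - + 4
  T′≡T-4 = threshold-shift (+ edgeCount G) (+ suc n) k

  shrink : HasBalancedAtLeast4 G T → HasBalancedAtLeast4 (deleteVertex G v) T′
  shrink (H , bal , T≤4h) = restrict v H , restrict-balanced v H bal ,
    subst (_≤ _) (sym T′≡T-4) (Equivalence.to (≤-4*suc⇔ T _) (≤-trans T≤4h (+≤+ (ℕ.*-monoʳ-≤ 4 h≤1+h′))))
    where
    h≤1+h′ : subEdgeCount H ℕ.≤ suc (subEdgeCount (restrict v H))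
    h≤1+h′ = subst (λ d → subEdgeCount H ℕ.≤ d ℕ.+ subEdgeCount (restrict v H)) deg (subEdgeCount-restrict v H)

  grow : HasBalancedAtLeast4 (deleteVertex G v) T′ → HasBalancedAtLeast4 G T
  grow (H′ , bal′ , T′≤4h′) with soleNeighbour G v deg
  ... | u , sole = extend G v H′ , extend-balanced G v H′ u sole bal′ ,
    subst (λ h → T ≤ + (4 ℕ.* h)) (sym h≡1+h′) (Equivalence.from (≤-4*suc⇔ T _) (subst (_≤ _) T′≡T-4 T′≤4h′))
    where
    h≡1+h′ : subEdgeCount (extend G v H′) ≡ suc (subEdgeCount H′)
    h≡1+h′ = trans (subEdgeCount-extend G v H′) (cong (ℕ._+ subEdgeCount H′) deg)
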